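{- Let $P\subseteq\mathrm{Act}^\infty$. If, in some monitoring system, there is a monitor that is sound and satisfaction-complete for $P$, then every $f\in P$ has a finite prefix that positively determines $P$. Likewise, if there is a monitor that is sound and violation-complete for $P$, then every $f\in\mathrm{Act}^\infty\setminus P$ has a finite prefix that negatively determines $P$.
   Context: $\mathrm{Act}$ is a finite set of actions, $\mathrm{Act}^\infty=\mathrm{Act}^*\cup\mathrm{Act}^\omega$. A finite trace $s$ positively (resp. negatively) determines $P$ if $sf\in P$ (resp. $sf\notin P$) for all $f\in\mathrm{Act}^\infty$. A monitoring system is a triple $(M,\mathrm{acc},\mathrm{rej})$ with $M$ nonempty, $\mathrm{acc},\mathrm{rej}\subseteq M\times\mathrm{Act}^\infty$, such that for every $m$: (1) $\mathrm{acc}(m,f)$ implies $\mathrm{acc}(m,s)$ for some finite prefix $s$ of $f$, likewise for $\mathrm{rej}$; (2) $\mathrm{acc}(m,s)$ for finite $s$ implies $\mathrm{acc}(m,sf)$ for all $f$, likewise for $\mathrm{rej}$. $m$ is sound for $P$ if $\mathrm{acc}(m,f)\Rightarrow f\in P$ and $\mathrm{rej}(m,f)\Rightarrow f\notin P$; satisfaction-complete if $f\in P\Rightarrow\mathrm{acc}(m,f)$; violation-complete if $f\notin P\Rightarrow\mathrm{rej}(m,f)$. -}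

module Defs where

open import Data.Nat using (ℕ; _<_; _+_)
open import Data.List using (List; []; _∷_; _++_; length)
open import Data.Fin using (Fin; toℕ)
open import Data.Sum using (_⊎_; inj₁; inj₂)
open import Data.Product using (Σ; ∃; ∃-syntax; _×_)
open import Relation.Binary.PropositionalEquality using (_≡_)
open import Relation.Nullary using (¬_)

Trace : Set → Set
Trace Act = List Act ⊎ (ℕ → Act)

fin : {Act : Set} → List Act → Trace Act
fin = inj₁

_++ω_ : {Act : Set} → List Act → (ℕ → Act) → (ℕ → Act)
([] ++ω w) i = w i
((a ∷ s) ++ω w) ℕ.zero = a
((a ∷ s) ++ω w) (ℕ.suc i) = (s ++ω w) i

_·_ : {Act : Set} → List Act → Trace Act → Trace Act
s · inj₁ t = inj₁ (s ++ t)
s · inj₂ w = inj₂ (s ++ω w)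

_≼_ : {Act : Set} → List Act → Trace Act → Set
s ≼ inj₁ t = ∃[ g ] (s ++ g ≡ t)
s ≼ inj₂ w = ∃[ g ] (∀ i → (s ++ω g) i ≡ w i)

PosDet : {Act : Set} → (Trace Act → Set) → List Act → Set
PosDet P s = ∀ f → P (s · f)

NegDet : {Act : Set} → (Trace Act → Set) → List Act → Set
NegDet P s = ∀ f → ¬ P (s · f)

record MonitoringSystem (Act : Set) : Set₁ where
  field
    M       : Set
    nonempty : M
    acc     : M → Trace Act → Set
    rej     : M → Trace Act → Set
    acc-fin : ∀ m f → acc m f → ∃[ s ] (s ≼ f × acc m (fin s))
    rej-fin : ∀ m f → rej m f → ∃[ s ] (s ≼ f × rej m (fin s))
    acc-ext : ∀ m s → acc m (fin s) → ∀ f → acc m (s · f)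
    rej-ext : ∀ m s → rej m (fin s) → ∀ f → rej m (s · f)

module _ {Act : Set} (S : MonitoringSystem Act) (P : Trace Act → Set) where
  open MonitoringSystem S

  Sound : M → Set
  Sound m = (∀ f → acc m f → P f) × (∀ f → rej m f → ¬ P f)

  SatComplete : M → Set
  SatComplete m = ∀ f → P f → acc m f

  ViolComplete : M → Set
  ViolComplete m = ∀ f → ¬ P f → rej m f

module Submission where

open import Defs
open import Data.Nat using (ℕ)
open import Data.Fin using (Fin)
open import Data.Product using (Σ; ∃-syntax; _×_; _,_)
open import Relation.Nullary using (¬_)
open import Function.Bundles using (_↔_)

-- A sound monitor's verdict is reached on a finite prefix and persists under
-- every extension of it, so by soundness that prefix already decides P.
module _ {Act : Set} (S : MonitoringSystem Act) (P : Trace Act → Set) where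
  open MonitoringSystem S

  accepted-prefix-posDet : ∀ m → (∀ f → acc m f → P f) →
                           ∀ f → acc m f → ∃[ s ] (s ≼ f × PosDet P s)
  accepted-prefix-posDet m acc⇒P f accf with acc-fin m f accf
  ... | s , s≼f , accs = s , s≼f , λ g → acc⇒P (s · g) (acc-ext m s accs g)

  rejected-prefix-negDet : ∀ m → (∀ f → rej m f → ¬ P f) →
                           ∀ f → rej m f → ∃[ s ] (s ≼ f × NegDet P s)
  rejected-prefix-negDet m rej⇒¬P f rejf with rej-fin m f rejf
  ... | s , s≼f , rejs = s , s≼f , λ g → rej⇒¬P (s · g) (rej-ext m s rejs g)

lemma5 : (Act : Set) → (n : ℕ) → Act ↔ Fin n →
    (P : Trace Act → Set) →
    ((S : MonitoringSystem Act) → (m : MonitoringSystem.M S) →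
       Sound S P m → SatComplete S P m →
       ∀ f → P f → ∃[ s ] (s ≼ f × PosDet P s))
    ×
    ((S : MonitoringSystem Act) → (m : MonitoringSystem.M S) →
       Sound S P m → ViolComplete S P m →
       ∀ f → ¬ P f → ∃[ s ] (s ≼ f × NegDet P s))
lemma5 Act n _ P =
  (λ S m (acc⇒P , _) complete f Pf →
     accepted-prefix-posDet S P m acc⇒P f (complete f Pf)) ,
  (λ S m (_ , rej⇒¬P) complete f ¬Pf →
     rejected-prefix-negDet S P m rej⇒¬P f (complete f ¬Pf))
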